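{- The language $L_8=\{a^{3m} : m\geq1\}$ belongs to $\mathrm{RL}_1^V\setminus\mathrm{SLT}$.
   Context: A right-linear grammar is $(N,T,P,S)$ with rules of the form $A\to wB$ or $A\to w$, $A,B\in N$, $w\in T^*$; $\mathrm{RL}_n^V$ is the family of regular languages generated by some right-linear grammar with at most $n$ non-terminal symbols. For $k\geq1$, a language $L$ over an alphabet $V$ is strictly locally $k$-testable (family $\mathrm{SLT}_k$) if there are sets $B,I,E\subseteq V^k$ and a finite set $F$ of words of length at most $k-1$ such that $L$ consists of the words of $F$ together with exactly those words $a_1a_2\cdots a_n$ ($n\geq k$, $a_i\in V$) for which $a_1\cdots a_k\in B$, $a_{j+1}\cdots a_{j+k}\in I$ for every $j$ with $1\leq j\leq n-k-1$, and $a_{n-k+1}\cdots a_n\in E$. $\mathrm{SLT}=\bigcup_{k\geq1}\mathrm{SLT}_k$. -}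

module Defs where

open import Data.Nat using (ℕ; _≤_; _<_; _+_; _*_; _∸_)
open import Data.Fin using (Fin)
open import Data.List using (List; []; _∷_; _++_; length; take; drop; replicate)
open import Data.List.Membership.Propositional using (_∈_)
open import Data.List.Relation.Unary.All using (All)
open import Data.Product using (Σ; ∃; _×_; _,_)
open import Data.Sum using (_⊎_)
open import Relation.Binary.PropositionalEquality using (_≡_)
open import Function.Bundles using (_⇔_)

Language : Set → Set₁
Language T = List T → Set

data Rule (n : ℕ) (T : Set) : Set where
  _⟶_·_ : Fin n → List T → Fin n → Rule n T
  _⟶_   : Fin n → List T → Rule n T

record RLGrammar (n : ℕ) (T : Set) : Set where
  field
    rules : List (Rule n T)
    start : Fin n

open RLGrammar public

data Derives {n : ℕ} {T : Set} (G : RLGrammar n T) : Fin n → List T → Set where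
  term : ∀ {A w} → (A ⟶ w) ∈ rules G → Derives G A w
  step : ∀ {A B w u} → (A ⟶ w · B) ∈ rules G → Derives G B u → Derives G A (w ++ u)

Gen : ∀ {n T} → RLGrammar n T → Language T
Gen G w = Derives G (start G) w

_≐_ : ∀ {T} → Language T → Language T → Set
L ≐ M = ∀ w → L w ⇔ M w

RL : ℕ → {T : Set} → Language T → Set
RL n {T} L = Σ ℕ λ m → m ≤ n × Σ (RLGrammar m T) λ G → Gen G ≐ L

SLTAccepts : ∀ {T} (k : ℕ) (B I E F : List (List T)) → Language T
SLTAccepts k B I E F w =
    (length w < k × w ∈ F)
  ⊎ ( k ≤ length w
    × take k w ∈ B
    -- windows a_{j+1}…a_{j+k} for 1 ≤ j ≤ n-k-1
    × (∀ j → 1 ≤ j → j + k + 1 ≤ length w → take k (drop j w) ∈ I)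
    × drop (length w ∸ k) w ∈ E )

SLTₖ : ℕ → {T : Set} → Language T → Set
SLTₖ k {T} L =
  Σ (List (List T)) λ B → Σ (List (List T)) λ I → Σ (List (List T)) λ E →
  Σ (List (List T)) λ F →
    All (λ u → length u ≡ k) B × All (λ u → length u ≡ k) I ×
    All (λ u → length u ≡ k) E × All (λ u → length u < k) F ×
    (∀ w → L w ⇔ SLTAccepts k B I E F w)

SLT : {T : Set} → Language T → Set
SLT L = Σ ℕ λ k → 1 ≤ k × SLTₖ k L

data Letter : Set where
  a : Letter

L₈ : Language Letter
L₈ w = Σ ℕ λ m → 1 ≤ m × w ≡ replicate (3 * m) a

{-# OPTIONS --safe #-}
-- A single nonterminal S with rules S → aaa S | aaa generates L₈. Over a one-letter
-- alphabet every length-k factor of a word is a^k, so once a strictly locally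
-- k-testable description accepts some a^m with an interior window, it accepts all
-- longer powers a^n as well; but L₈ contains a^{3(k+1)} and not a^{3(k+1)+1}.
module Submission where

open import Defs
open import Data.Product using (_×_; Σ; _,_)
open import Relation.Nullary using (¬_)

open import Data.Nat using (ℕ; zero; suc; _+_; _*_; _∸_; _≤_; z≤n; s≤s)
open import Data.Nat.Properties
  using (≤-trans; <⇒≱; m≤m+n; m+n≤o⇒m≤o; m+n≤o⇒n≤o; +-monoʳ-≤; *-suc; *-identityʳ; m∸[m∸n]≡n)
open import Data.Nat.Divisibility using (_∣_; m∣m*n; ∣m+n∣m⇒∣n; ∣⇒≤)
open import Data.Fin using () renaming (zero to S)
open import Data.List using (List; []; _∷_; _++_; length; take; drop; replicate)
open import Data.List.Properties using (length-replicate)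
open import Data.List.Membership.Propositional using (_∈_)
open import Data.List.Relation.Unary.Any using (here; there)
open import Data.Sum using (inj₁; inj₂)
open import Data.Empty using (⊥-elim)
open import Relation.Binary.PropositionalEquality
  using (_≡_; _≢_; refl; sym; trans; cong; subst; module ≡-Reasoning)
open import Function.Bundles using (mk⇔; Equivalence)

module _ {T : Set} (x : T) where

  replicate-++ : ∀ m n → replicate m x ++ replicate n x ≡ replicate (m + n) x
  replicate-++ zero    n = refl
  replicate-++ (suc m) n = cong (x ∷_) (replicate-++ m n)

  replicate-injective : ∀ {m n} → replicate m x ≡ replicate n x → m ≡ n
  replicate-injective {m} {n} eq =
    trans (sym (length-replicate m)) (trans (cong length eq) (length-replicate n))

  take-replicate : ∀ {k n} → k ≤ n → take k (replicate n x) ≡ replicate k x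
  take-replicate z≤n      = refl
  take-replicate (s≤s le) = cong (x ∷_) (take-replicate le)

  drop-replicate : ∀ j n → drop j (replicate n x) ≡ replicate (n ∸ j) x
  drop-replicate zero    n       = refl
  drop-replicate (suc j) zero    = refl
  drop-replicate (suc j) (suc n) = drop-replicate j n

  window-replicate : ∀ j {k n} → j + k ≤ n → take k (drop j (replicate n x)) ≡ replicate k x
  window-replicate zero                 le       = take-replicate le
  window-replicate (suc j) {n = suc n} (s≤s le) = window-replicate j le

  suffix-replicate : ∀ {k n} → k ≤ n → drop (length (replicate n x) ∸ k) (replicate n x) ≡ replicate k x
  suffix-replicate {k} {n} le = begin
    drop (length (replicate n x) ∸ k) (replicate n x) ≡⟨ cong (λ l → drop (l ∸ k) (replicate n x)) (length-replicate n) ⟩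
    drop (n ∸ k) (replicate n x)                      ≡⟨ drop-replicate (n ∸ k) n ⟩
    replicate (n ∸ (n ∸ k)) x                         ≡⟨ cong (λ l → replicate l x) (m∸[m∸n]≡n le) ⟩
    replicate k x                                     ∎
    where open ≡-Reasoning

  interior⇒long : ∀ {k m} → 1 + k + 1 ≤ m → k ≤ m
  interior⇒long {k} window = m+n≤o⇒n≤o 1 (m+n≤o⇒m≤o (1 + k) window)

  module _ {k : ℕ} {B I E F : List (List T)} where

    SLTAccepts-replicate⇒∈ : ∀ {m} → 1 + k + 1 ≤ m → SLTAccepts k B I E F (replicate m x) →
                             replicate k x ∈ B × replicate k x ∈ I × replicate k x ∈ E
    SLTAccepts-replicate⇒∈ {m} window (inj₁ (short , _)) =
      ⊥-elim (<⇒≱ short (subst (k ≤_) (sym (length-replicate m)) (interior⇒long window)))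
    SLTAccepts-replicate⇒∈ {m} window (inj₂ (long , inB , inI , inE)) =
        subst (_∈ B) (take-replicate long′) inB
      , subst (_∈ I) (window-replicate 1 (m+n≤o⇒m≤o (1 + k) window))
              (inI 1 (s≤s z≤n) (subst (1 + k + 1 ≤_) (sym (length-replicate m)) window))
      , subst (_∈ E) (suffix-replicate long′) inE
      where
      long′ : k ≤ m
      long′ = subst (k ≤_) (length-replicate m) long

    ∈⇒SLTAccepts-replicate : ∀ {n} → k ≤ n →
                             replicate k x ∈ B × replicate k x ∈ I × replicate k x ∈ E →
                             SLTAccepts k B I E F (replicate n x)
    ∈⇒SLTAccepts-replicate {n} long (inB , inI , inE) = inj₂
      ( subst (k ≤_) (sym (length-replicate n)) long
      , subst (_∈ B) (sym (take-replicate long)) inB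
      , (λ j _ fits → subst (_∈ I)
          (sym (window-replicate j (m+n≤o⇒m≤o (j + k) (subst (j + k + 1 ≤_) (length-replicate n) fits))))
          inI)
      , subst (_∈ E) (sym (suffix-replicate long)) inE )

  SLTₖ-replicate-upward : ∀ {k m n} {L : Language T} → SLTₖ k L → 1 + k + 1 ≤ m → m ≤ n →
                          L (replicate m x) → L (replicate n x)
  SLTₖ-replicate-upward {k} {m} {n} (B , I , E , F , _ , _ , _ , _ , L⇔) window m≤n Lm =
    Equivalence.from (L⇔ (replicate n x))
      (∈⇒SLTAccepts-replicate (≤-trans (interior⇒long window) m≤n)
        (SLTAccepts-replicate⇒∈ window (Equivalence.to (L⇔ (replicate m x)) Lm)))

  module _ (d : ℕ) where

    PositiveMultiples : Language T
    PositiveMultiples w = Σ ℕ λ m → 1 ≤ m × w ≡ replicate (d * m) x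

    replicate-*-suc : ∀ m → replicate d x ++ replicate (d * m) x ≡ replicate (d * suc m) x
    replicate-*-suc m = trans (replicate-++ d (d * m)) (cong (λ l → replicate l x) (sym (*-suc d m)))

    multiplesGrammar : RLGrammar 1 T
    multiplesGrammar = record
      { rules = (S ⟶ replicate d x · S) ∷ (S ⟶ replicate d x) ∷ []
      ; start = S
      }

    multiplesGrammar-sound : ∀ {A w} → Derives multiplesGrammar A w → PositiveMultiples w
    multiplesGrammar-sound (term (there (here refl))) =
      1 , s≤s z≤n , cong (λ l → replicate l x) (sym (*-identityʳ d))
    multiplesGrammar-sound (term (there (there ())))
    multiplesGrammar-sound (step (here refl) derivation) with multiplesGrammar-sound derivation
    ... | m , _ , refl = suc m , s≤s z≤n , replicate-*-suc m
    multiplesGrammar-sound (step (there (there ())) _)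

    multiplesGrammar-complete : ∀ m → Gen multiplesGrammar (replicate (d * suc m) x)
    multiplesGrammar-complete zero    = subst (Gen multiplesGrammar)
                                          (cong (λ l → replicate l x) (sym (*-identityʳ d)))
                                          (term (there (here refl)))
    multiplesGrammar-complete (suc m) = subst (Gen multiplesGrammar) (replicate-*-suc (suc m))
                                          (step (here refl) (multiplesGrammar-complete m))

    PositiveMultiples∈RL₁ : RL 1 PositiveMultiples
    PositiveMultiples∈RL₁ = 1 , s≤s z≤n , multiplesGrammar , λ w →
      mk⇔ multiplesGrammar-sound λ { (suc m , _ , refl) → multiplesGrammar-complete m }

3*q+1≢3*m : ∀ q m → 3 * q + 1 ≢ 3 * m
3*q+1≢3*m q m eq = <⇒≱ (s≤s (s≤s z≤n)) (∣⇒≤ 3∣1)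
  where
  3∣1 : 3 ∣ 1
  3∣1 = ∣m+n∣m⇒∣n (subst (3 ∣_) (sym eq) (m∣m*n m)) (m∣m*n q)

L₈∉SLT : ¬ SLT L₈
L₈∉SLT (k , _ , slt) =
  a^3[k+1]+1∉L₈ (SLTₖ-replicate-upward a slt interiorWindow (m≤m+n (3 * suc k) 1) (suc k , s≤s z≤n , refl))
  where
  interiorWindow : 1 + k + 1 ≤ 3 * suc k
  interiorWindow = s≤s (+-monoʳ-≤ k (s≤s z≤n))

  a^3[k+1]+1∉L₈ : ¬ L₈ (replicate (3 * suc k + 1) a)
  a^3[k+1]+1∉L₈ (m , _ , eq) = 3*q+1≢3*m (suc k) m (replicate-injective a eq)

lemma8 : RL 1 L₈ × ¬ SLT L₈
lemma8 = PositiveMultiples∈RL₁ a 3 , L₈∉SLT
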